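{- Let $G_4$ be the graph with vertex set $\{u_1,u_2,v_1,v_2,v_3,v_4\}$ and edge set $\{v_1v_2,v_1v_3,v_2v_3,v_2v_4,v_3v_4,u_1v_1,u_2v_2\}$ (i.e. $K_4$ on $v_1,\dots,v_4$ minus the edge $v_1v_4$, with a pendent vertex $u_1$ attached at $v_1$ and a pendent vertex $u_2$ attached at $v_2$). Then every orientation $D$ of $G_4$ satisfies $M_1(D)<19$.
   Context: An orientation $D$ of a graph is obtained by replacing each edge $xy$ by exactly one of the arcs $xy$ or $yx$. For a vertex $x$ of $D$, $d^+_x$ and $d^-_x$ denote its out-degree and in-degree. The first Zagreb index of a digraph $D=(V,A)$ is $M_1(D)=\frac{1}{2}\sum_{xy\in A}(d^+_x+d^-_y)$. -}

module Defs where

open import Data.Nat using (ℕ; _+_)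
open import Data.Fin using (Fin; zero; suc; _≟_)
open import Data.Bool using (Bool; true; false)
open import Data.Product using (_×_; _,_; proj₁; proj₂)
open import Data.List using (List; []; _∷_; length; map; filter; lookup; allFin)
open import Data.Nat.ListAction using (sum)
open import Data.Integer using (+_)
open import Data.Rational.Unnormalised using (ℚᵘ; _/_)

Edge : ℕ → Set
Edge n = Fin n × Fin n

-- A graph on Fin n given by its list of edges (each edge listed once).
Graph : ℕ → Set
Graph n = List (Edge n)

Orientation : ∀ {n} → Graph n → Set
Orientation es = Fin (length es) → Bool

orient : ∀ {n} → Edge n → Bool → Edge n
orient (x , y) true  = (x , y)
orient (x , y) false = (y , x)

arcs : ∀ {n} (es : Graph n) → Orientation es → List (Edge n)
arcs es o = map (λ i → orient (lookup es i) (o i)) (allFin (length es))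

outdeg : ∀ {n} → List (Edge n) → Fin n → ℕ
outdeg A x = length (filter (λ a → proj₁ a ≟ x) A)

indeg : ∀ {n} → List (Edge n) → Fin n → ℕ
indeg A x = length (filter (λ a → proj₂ a ≟ x) A)

M₁ : ∀ {n} → List (Edge n) → ℚᵘ
M₁ A = (+ sum (map (λ a → outdeg A (proj₁ a) + indeg A (proj₂ a)) A)) / 2

u₁ u₂ v₁ v₂ v₃ v₄ : Fin 6
u₁ = zero
u₂ = suc zero
v₁ = suc (suc zero)
v₂ = suc (suc (suc zero))
v₃ = suc (suc (suc (suc zero)))
v₄ = suc (suc (suc (suc (suc zero))))

G₄ : Graph 6
G₄ = (v₁ , v₂) ∷ (v₁ , v₃) ∷ (v₂ , v₃) ∷ (v₂ , v₄) ∷ (v₃ , v₄)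
   ∷ (u₁ , v₁) ∷ (u₂ , v₂) ∷ []

-- M₁ of a digraph is computable and G₄ has only 2⁷ orientations, each of them
-- the lookup function of a Boolean vector indexed by the edges; deciding the
-- bound over all such vectors, the decision evaluates to yes.
module Submission where

open import Defs
open import Level using (Level)
open import Data.Integer using (+_)
open import Data.Nat using (ℕ)
open import Data.List using (List)
open import Data.List.Properties using (map-cong)
open import Data.Product using (_,_)
open import Data.Rational.Unnormalised using (_<_; _/_; _<?_)
open import Data.Fin.Subset using (Subset)
open import Data.Fin.Subset.Properties using (anySubset?)
open import Data.Vec using (lookup; tabulate)
open import Data.Vec.Properties using (lookup∘tabulate)
open import Function using (_∘_)
open import Relation.Binary.PropositionalEquality using (_≡_; _≗_; cong; subst)
open import Relation.Nullary using (Dec; yes; no; ¬?)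
open import Relation.Nullary.Decidable using (map′; decidable-stable; toWitness)
open import Relation.Nullary.Negation using (¬∃⟶∀¬)
open import Relation.Unary using (Pred; Decidable)

private
  variable
    ℓ : Level
    n : ℕ

allSubset? : {P : Pred (Subset n) ℓ} → Decidable P → Dec (∀ p → P p)
allSubset? P? with anySubset? (¬? ∘ P?)
... | yes (p , ¬Pp) = no λ ∀P → ¬Pp (∀P p)
... | no ¬∃¬P       = yes λ p → decidable-stable (P? p) (¬∃⟶∀¬ ¬∃¬P p)

arcs-cong : (es : Graph n) {D D′ : Orientation es} → D ≗ D′ → arcs es D ≡ arcs es D′
arcs-cong es D≗D′ = map-cong (λ i → cong (orient _) (D≗D′ i)) _

allOrientations? : (es : Graph n) {P : Pred (List (Edge n)) ℓ} → Decidable P →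
                   Dec (∀ (D : Orientation es) → P (arcs es D))
allOrientations? es {P} P? =
  map′ fromVectors (λ ∀P → ∀P ∘ lookup) (allSubset? (P? ∘ arcs es ∘ lookup))
  where
  fromVectors : (∀ p → P (arcs es (lookup p))) → ∀ D → P (arcs es D)
  fromVectors ∀P D = subst P (arcs-cong es (lookup∘tabulate D)) (∀P (tabulate D))

lemma6 : (D : Orientation G₄) → M₁ (arcs G₄ D) < (+ 19) / 1
lemma6 = toWitness {a? = allOrientations? G₄ (λ A → M₁ A <? (+ 19) / 1)} _
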